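{- Let $G$ be a graph admitting a valid decomposition tree $T$ (with map $\varphi$), let $\mathcal{S}$ be a set of subsets of $V(G)$, and let $\ell$ be an $\mathcal{S}$-labeling of $T$. Suppose that for every node $t$ of $T$ with children $s,s'$: (1) $\ell(t)\not\subseteq\varphi(s)$ and $\ell(t)\not\subseteq\varphi(s')$; and (2) unless $s$ or $s'$ is a leaf, no member of $\mathcal{S}$ is included in $\varphi(s)\cap\varphi(s')$. Then $\ell$ is injective, i.e. $\ell(t)\neq\ell(t')$ for all distinct internal nodes $t\neq t'$.
   Context: A cut of $G$ is a partition $(W,W')$ of $V(G)$; it separates disjoint $K,S$ if $K\subseteq W$, $S\subseteq W'$. A CS-Separator of $G$ is a finite family of cuts such that every clique $K$ and stable set $S$ with $K\cap S=\emptyset$ are separated by some member; its size is the number of cuts. A decomposition of $G$ is a pair $(G_1,G_2)$ of proper induced subgraphs of $G$; it is valid if whenever $G_1,G_2$ have CS-Separators of sizes $f_1,f_2$, $G$ has a CS-Separator of size $f_1+f_2$. A valid decomposition tree for $G$ is a rooted tree $T$ in which every non-leaf (internal) node has exactly two children, with a map $\varphi:V(T)\to\mathcal{P}(V(G))$ such that $\varphi(\text{root})=V(G)$ and for every node $t$ with children $s,s'$, $(G[\varphi(s)],G[\varphi(s')])$ is a valid decomposition of $G[\varphi(t)]$. An $\mathcal{S}$-labeling of $T$ is a map $\ell$ from the set of internal nodes of $T$ to $\mathcal{S}$ with $\ell(t)\subseteq\varphi(t)$ for every internal node $t$. -}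

module Defs where

open import Data.Nat using (ℕ; _+_)
open import Data.Fin using (Fin)
open import Data.Fin.Subset using (Subset; _∈_; _∉_; _⊆_; _⊂_; _∩_; _∪_; ⊤; Empty)
open import Data.List using (List; length)
open import Data.List.Relation.Unary.All using (All)
open import Data.List.Relation.Unary.Any using (Any)
open import Data.List.Relation.Unary.Unique.Propositional using (Unique)
open import Data.Product using (Σ; _×_; _,_; ∃)
open import Relation.Binary.PropositionalEquality using (_≡_; _≢_)
open import Relation.Nullary using (¬_)

record Graph (n : ℕ) : Set₁ where
  field
    E       : Fin n → Fin n → Set
    E-sym   : ∀ {u v} → E u v → E v u
    E-irrfl : ∀ {u} → ¬ E u u

module _ {n : ℕ} (G : Graph n) where
  open Graph G

  IsClique : Subset n → Set
  IsClique K = ∀ {u v} → u ∈ K → v ∈ K → u ≢ v → E u v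

  IsStable : Subset n → Set
  IsStable S = ∀ {u v} → u ∈ S → v ∈ S → ¬ E u v

  -- The induced subgraph G[X] is represented by its vertex set X ⊆ V(G);
  -- cliques / stable sets of G[X] are exactly the cliques / stable sets
  -- of G contained in X.

  Cut : Set
  Cut = Subset n × Subset n

  IsCutOf : Subset n → Cut → Set
  IsCutOf X (W , W') = Empty (W ∩ W') × (W ∪ W' ≡ X)

  Separates : Cut → Subset n → Subset n → Set
  Separates (W , W') K S = K ⊆ W × S ⊆ W'

  -- A CS-Separator of G[X]: a finite family (list without repetition)
  -- of cuts of G[X] separating every disjoint clique / stable set pair.
  IsCSSeparator : Subset n → List Cut → Set
  IsCSSeparator X F =
    Unique F × All (IsCutOf X) F ×
    (∀ K S → K ⊆ X → S ⊆ X → IsClique K → IsStable S →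
       Empty (K ∩ S) → Any (λ c → Separates c K S) F)

  HasCSSeparatorOfSize : Subset n → ℕ → Set
  HasCSSeparatorOfSize X f =
    Σ (List Cut) (λ F → IsCSSeparator X F × length F ≡ f)

  IsValidDecomposition : Subset n → Subset n → Subset n → Set
  IsValidDecomposition X X₁ X₂ =
    X₁ ⊂ X × X₂ ⊂ X ×
    (∀ f₁ f₂ → HasCSSeparatorOfSize X₁ f₁ → HasCSSeparatorOfSize X₂ f₂ →
       HasCSSeparatorOfSize X (f₁ + f₂))

data Tree : Set where
  leaf : Tree
  node : Tree → Tree → Tree

-- nodes of a tree (as positions / paths from the root)
data Pos : Tree → Set where
  here : ∀ {t} → Pos t
  goL  : ∀ {l r} → Pos l → Pos (node l r)
  goR  : ∀ {l r} → Pos r → Pos (node l r)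

data IPos : Tree → Set where
  here : ∀ {l r} → IPos (node l r)
  goL  : ∀ {l r} → IPos l → IPos (node l r)
  goR  : ∀ {l r} → IPos r → IPos (node l r)

root : ∀ {t} → Pos t
root = here

toPos : ∀ {t} → IPos t → Pos t
toPos here    = here
toPos (goL p) = goL (toPos p)
toPos (goR p) = goR (toPos p)

childL childR : ∀ {t} → IPos t → Pos t
childL here    = goL here
childL (goL p) = goL (childL p)
childL (goR p) = goR (childL p)
childR here    = goR here
childR (goL p) = goL (childR p)
childR (goR p) = goR (childR p)

subtree : (t : Tree) → Pos t → Tree
subtree t          here    = t
subtree (node l r) (goL p) = subtree l p
subtree (node l r) (goR p) = subtree r p

IsLeaf : ∀ {t} → Pos t → Set
IsLeaf {t} p = subtree t p ≡ leaf

IsValidDecompositionTree : ∀ {n} → Graph n → (T : Tree) → (Pos T → Subset n) → Set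
IsValidDecompositionTree G T φ =
  φ root ≡ ⊤ ×
  (∀ (t : IPos T) → IsValidDecomposition G (φ (toPos t)) (φ (childL t)) (φ (childR t)))

Is𝒮Labeling : ∀ {n} (T : Tree) → (Pos T → Subset n) → (Subset n → Set) →
              (IPos T → Subset n) → Set
Is𝒮Labeling T φ 𝒮 ℓ = ∀ (t : IPos T) → 𝒮 (ℓ t) × ℓ t ⊆ φ (toPos t)

module Submission where

-- In a valid decomposition the two parts are proper induced
-- subgraphs, so along the tree the vertex sets only shrink: φ(s) ⊆ φ(t)
-- whenever s is a child of t.  Consequently the label of any internal node
-- lying in the left (right) subtree of t is contained in φ of the left
-- (right) child of t.  Now take internal nodes t ≠ t′ with ℓ t = ℓ t′ and
-- induct on the tree:
--   * if one of them is the root, the other one lies in, say, the left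
--     subtree, so the root label is contained in φ(left child) —
--     contradicting condition (1);
--   * if they lie in different subtrees, neither child of the root is a
--     leaf and the common label, a member of 𝒮, lies in the intersection
--     of the children's sets — contradicting condition (2);
--   * if they lie in the same subtree, the induction hypothesis applies.

open import Defs
open import Data.Fin.Subset using (Subset; _∈_; _⊆_; _∩_)
open import Data.Fin.Subset.Properties using (x∈p∩q⁺)
open import Data.Product using (_×_; _,_; proj₁; proj₂)
open import Data.Empty using (⊥-elim)
open import Relation.Binary.PropositionalEquality using (_≡_; _≢_; refl; cong; sym; subst)
open import Relation.Nullary using (¬_)

Monotone : ∀ {n} (T : Tree) → (Pos T → Subset n) → Set
Monotone T φ = ∀ (t : IPos T) → φ (childL t) ⊆ φ (toPos t) × φ (childR t) ⊆ φ (toPos t)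

validTree⇒monotone : ∀ {n} (G : Graph n) (T : Tree) (φ : Pos T → Subset n) →
  IsValidDecompositionTree G T φ → Monotone T φ
validTree⇒monotone G T φ (_ , valid) t =
  proj₁ (proj₁ (valid t)) , proj₁ (proj₁ (proj₂ (valid t)))

monotone⇒⊆root : ∀ {n} (T : Tree) (φ : Pos T → Subset n) → Monotone T φ →
  ∀ (t : IPos T) → φ (toPos t) ⊆ φ root
monotone⇒⊆root (node l r) φ mono here    = λ x∈ → x∈
monotone⇒⊆root (node l r) φ mono (goL t) =
  λ x∈ → proj₁ (mono here) (monotone⇒⊆root l (λ p → φ (goL p)) (λ s → mono (goL s)) t x∈)
monotone⇒⊆root (node l r) φ mono (goR t) =
  λ x∈ → proj₂ (mono here) (monotone⇒⊆root r (λ p → φ (goR p)) (λ s → mono (goR s)) t x∈)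

internal⇒¬leaf : ∀ {T} → IPos T → ¬ (T ≡ leaf)
internal⇒¬leaf here    ()
internal⇒¬leaf (goL _) ()
internal⇒¬leaf (goR _) ()

labels-injective : ∀ {n} (T : Tree) (φ : Pos T → Subset n) (𝒮 : Subset n → Set)
  (ℓ : IPos T → Subset n) → Monotone T φ → Is𝒮Labeling T φ 𝒮 ℓ →
  (∀ (t : IPos T) → ¬ (ℓ t ⊆ φ (childL t)) × ¬ (ℓ t ⊆ φ (childR t))) →
  (∀ (t : IPos T) → ¬ IsLeaf (childL t) → ¬ IsLeaf (childR t) →
     ∀ X → 𝒮 X → ¬ (X ⊆ φ (childL t) ∩ φ (childR t))) →
  ∀ (t t′ : IPos T) → ℓ t ≡ ℓ t′ → t ≡ t′
labels-injective (node l r) φ 𝒮 ℓ mono labeling splits noMemberInOverlap = go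
  where
  injectiveL : ∀ (t t′ : IPos l) → ℓ (goL t) ≡ ℓ (goL t′) → t ≡ t′
  injectiveL = labels-injective l (λ p → φ (goL p)) 𝒮 (λ t → ℓ (goL t))
    (λ t → mono (goL t)) (λ t → labeling (goL t)) (λ t → splits (goL t)) (λ t → noMemberInOverlap (goL t))

  injectiveR : ∀ (t t′ : IPos r) → ℓ (goR t) ≡ ℓ (goR t′) → t ≡ t′
  injectiveR = labels-injective r (λ p → φ (goR p)) 𝒮 (λ t → ℓ (goR t))
    (λ t → mono (goR t)) (λ t → labeling (goR t)) (λ t → splits (goR t)) (λ t → noMemberInOverlap (goR t))

  labelL⊆childL : ∀ (t : IPos l) → ℓ (goL t) ⊆ φ (childL here)
  labelL⊆childL t x∈ =
    monotone⇒⊆root l (λ p → φ (goL p)) (λ s → mono (goL s)) t (proj₂ (labeling (goL t)) x∈)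

  labelR⊆childR : ∀ (t : IPos r) → ℓ (goR t) ⊆ φ (childR here)
  labelR⊆childR t x∈ =
    monotone⇒⊆root r (λ p → φ (goR p)) (λ s → mono (goR s)) t (proj₂ (labeling (goR t)) x∈)

  root≢left : ∀ (t : IPos l) → ℓ here ≢ ℓ (goL t)
  root≢left t e = proj₁ (splits here) (subst (_⊆ φ (childL here)) (sym e) (labelL⊆childL t))

  root≢right : ∀ (t : IPos r) → ℓ here ≢ ℓ (goR t)
  root≢right t e = proj₂ (splits here) (subst (_⊆ φ (childR here)) (sym e) (labelR⊆childR t))

  left≢right : ∀ (t : IPos l) (t′ : IPos r) → ℓ (goL t) ≢ ℓ (goR t′)
  left≢right t t′ e =
    noMemberInOverlap here (internal⇒¬leaf t) (internal⇒¬leaf t′) (ℓ (goL t)) (proj₁ (labeling (goL t)))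
      (λ x∈ → x∈p∩q⁺ (labelL⊆childL t x∈ , labelR⊆childR t′ (subst (_ ∈_) e x∈)))

  go : ∀ (t t′ : IPos (node l r)) → ℓ t ≡ ℓ t′ → t ≡ t′
  go here    here     _ = refl
  go here    (goL t′) e = ⊥-elim (root≢left t′ e)
  go here    (goR t′) e = ⊥-elim (root≢right t′ e)
  go (goL t) here     e = ⊥-elim (root≢left t (sym e))
  go (goR t) here     e = ⊥-elim (root≢right t (sym e))
  go (goL t) (goR t′) e = ⊥-elim (left≢right t t′ e)
  go (goR t) (goL t′) e = ⊥-elim (left≢right t′ t (sym e))
  go (goL t) (goL t′) e = cong goL (injectiveL t t′ e)
  go (goR t) (goR t′) e = cong goR (injectiveR t t′ e)

lemma2 : ∀ {n} (G : Graph n) (T : Tree) (φ : Pos T → Subset n) →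
    IsValidDecompositionTree G T φ →
    (𝒮 : Subset n → Set) (ℓ : IPos T → Subset n) →
    Is𝒮Labeling T φ 𝒮 ℓ →
    (∀ (t : IPos T) → ¬ (ℓ t ⊆ φ (childL t)) × ¬ (ℓ t ⊆ φ (childR t))) →
    (∀ (t : IPos T) → ¬ IsLeaf (childL t) → ¬ IsLeaf (childR t) →
       ∀ X → 𝒮 X → ¬ (X ⊆ φ (childL t) ∩ φ (childR t))) →
    ∀ (t t′ : IPos T) → t ≢ t′ → ℓ t ≢ ℓ t′
lemma2 G T φ validTree 𝒮 ℓ labeling splits noMemberInOverlap t t′ t≢t′ same =
  t≢t′ (labels-injective T φ 𝒮 ℓ (validTree⇒monotone G T φ validTree)
         labeling splits noMemberInOverlap t t′ same)
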